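{- For every $n\ge1$, the labeling $\lambda_\bullet$ of $\Pi_n^\bullet$ satisfies the rank two switching property: for every interval $[x,y]$ of $\Pi_n^\bullet$ with $\rho(y)-\rho(x)=2$, if the unique increasing maximal chain of $[x,y]$ has label sequence $ab$, then there is exactly one maximal chain of $[x,y]$ with label sequence $ba$.
   Context: A pointed set is a pair $(A,p)$, written $A^p$, with $A$ nonempty finite and $p\in A$. A pointed partition of $[n]$ is a collection of pointed sets whose underlying sets form a set partition of $[n]$. In $\Pi_n^\bullet$, $\pi\lessdot\pi'$ exactly when $\pi'$ is obtained from $\pi$ by replacing two blocks $A^p,B^q$ (with $\min A<\min B$) by $(A\cup B)^p$ (a $1$-merge) or $(A\cup B)^q$ (a $0$-merge), other blocks unchanged; the rank $\rho$ is $n$ minus the number of blocks. The labeling $\lambda_\bullet$ assigns to a $u$-merge the label $(\min A,\min B)^u$, valued in the poset $\Lambda_n^\bullet$ whose elements are $(a,b)^u$ with $1\le a<b\le n$, $u\in\{0,1\}$, ordered as the ordinal sum $A_1\oplus C_1\oplus\cdots\oplus A_{n-1}\oplus C_{n-1}$, where $A_a$ is the antichain $\{(a,b)^0:a<b\le n\}$ and $C_a$ is the chain $\{(a,b)^1\}$ with $(a,b)^1<(a,c)^1$ iff $b<c$. A saturated chain is increasing if its consecutive labels strictly increase in $\Lambda_n^\bullet$; every interval has a unique increasing maximal chain for this labeling. -}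

module Defs where

open import Data.Nat using (ℕ)
open import Data.Fin using (Fin; _<_; _≤_; _≟_)
open import Data.Vec using (Vec; lookup; map)
open import Data.Bool using (Bool; true; false; if_then_else_; _∨_)
open import Data.Product using (Σ; _×_; Σ-syntax)
open import Data.Sum using (_⊎_)
open import Relation.Nullary.Decidable using (⌊_⌋)
open import Relation.Binary.PropositionalEquality using (_≡_)

-- Ground set [n] is represented by Fin n (element k+1 of [n] is the Fin value k;
-- the order of [n] is the order of Fin n).
--
-- A pointed partition of [n] is encoded by the vector v with
--   v[i] = the point of the block containing i.
-- Blocks are the fibres of v and each block's point is the unique fixed point of
-- v in it; the only condition is that the point of a block lies in the block:
IsPointedPartition : {n : ℕ} → Vec (Fin n) n → Set
IsPointedPartition v = ∀ i → lookup v (lookup v i) ≡ lookup v i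

IsBlockMin : {n : ℕ} → Vec (Fin n) n → Fin n → Fin n → Set
IsBlockMin x p m = (lookup x m ≡ p) × (∀ i → lookup x i ≡ p → m ≤ i)

mergeBlocks : {n : ℕ} → Vec (Fin n) n → Fin n → Fin n → Fin n → Vec (Fin n) n
mergeBlocks x p q r = map (λ c → if ⌊ c ≟ p ⌋ ∨ ⌊ c ≟ q ⌋ then r else c) x

-- Labels (a,b)^u of Λ_n^•; u = true means u = 1, u = false means u = 0.
record Label (n : ℕ) : Set where
  constructor lab
  field
    a : Fin n
    b : Fin n
    u : Bool
open Label public

-- Strict order of Λ_n^• = A_1 ⊕ C_1 ⊕ ... ⊕ A_{n-1} ⊕ C_{n-1}
_<Λ_ : {n : ℕ} → Label n → Label n → Set
l <Λ l' =
    (a l < a l')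
  ⊎ ((a l ≡ a l') × (u l ≡ false) × (u l' ≡ true))
  ⊎ ((a l ≡ a l') × (u l ≡ true) × (u l' ≡ true) × (b l < b l'))

-- Cover x ⋖ y in Π_n^• obtained by a u-merge with label l = (min A, min B)^u:
-- blocks A (point p) and B (point q) of x with min A < min B are merged, the new
-- point being p for a 1-merge and q for a 0-merge.
MergeLabel : {n : ℕ} → Vec (Fin n) n → Vec (Fin n) n → Label n → Set
MergeLabel x y l =
  Σ[ p ∈ _ ] Σ[ q ∈ _ ]
      (lookup x p ≡ p) × (lookup x q ≡ q)
    × IsBlockMin x p (a l) × IsBlockMin x q (b l)
    × (a l < b l)
    × (y ≡ mergeBlocks x p q (if u l then p else q))

{-# OPTIONS --safe #-}
module Submission where

open import Defs
open import Data.Nat using (ℕ; _≤_)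
open import Data.Fin using (Fin)
open import Data.Vec using (Vec)
open import Data.Product using (Σ; _×_; Σ-syntax)
open import Relation.Binary.PropositionalEquality using (_≡_)

open import Data.Bool using (Bool; true; false; if_then_else_; _∨_)
open import Data.Empty using (⊥-elim)
open import Data.Fin using (_≟_; toℕ) renaming (_≤_ to _≤ᶠ_; _<_ to _<ᶠ_)
open import Data.Fin.Properties using (≤-antisym; <⇒≢)
open import Data.Nat.Properties using (<⇒≤; ≤-reflexive; ≤-<-trans; ≤-trans)
open import Data.Product using (_,_; proj₁; proj₂)
open import Data.Sum using (_⊎_; inj₁; inj₂; [_,_])
open import Data.Vec using (lookup; map)
open import Data.Vec.Properties using (lookup-map; map-∘; map-cong)
open import Function using (_∘_)
open import Relation.Nullary using (yes; no)
open import Relation.Nullary.Decidable using (⌊_⌋)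
open import Relation.Binary.PropositionalEquality
  using (_≢_; _≗_; refl; sym; trans; cong; subst; module ≡-Reasoning)

-- The two merges of a rank-two interval x ⋖ z ⋖ y either join disjoint pairs of blocks of x,
-- and then they can be performed in either order, or the second one joins the block created
-- by the first, whose minimum is a, to a third block S. In that case l₁ <Λ l₂ forces the second
-- label to be (a, min S)¹, and merging S into the block of a first and the block of b second
-- reaches y again. The reversed chain is unique because a cover is determined by its bottom
-- element and its label.

≢-either : ∀ {A : Set} {c p q r : A} → c ≢ p → c ≢ q → r ≡ p ⊎ r ≡ q → c ≢ r
≢-either c≢p _ (inj₁ r≡p) c≡r = c≢p (trans c≡r r≡p)
≢-either _ c≢q (inj₂ r≡q) c≡r = c≢q (trans c≡r r≡q)

if-either : ∀ {A : Set} (b : Bool) (p q : A) → (if b then p else q) ≡ p ⊎ (if b then p else q) ≡ q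
if-either true  _ _ = inj₁ refl
if-either false _ _ = inj₂ refl

map-exchange : ∀ {A B C : Set} {m} {f : B → C} {g : A → B} {h : B → C} {k : A → B} →
               f ∘ g ≗ h ∘ k → (xs : Vec A m) → map f (map g xs) ≡ map h (map k xs)
map-exchange {f = f} {g} {h} {k} f∘g≗h∘k xs =
  trans (sym (map-∘ f g xs)) (trans (map-cong f∘g≗h∘k xs) (map-∘ h k xs))

module _ {n : ℕ} where

  merge : Fin n → Fin n → Fin n → Fin n → Fin n
  merge p q r c = if ⌊ c ≟ p ⌋ ∨ ⌊ c ≟ q ⌋ then r else c

  merge-≡ʳ : ∀ p q r {c} → c ≡ p ⊎ c ≡ q → merge p q r c ≡ r
  merge-≡ʳ p q r {c} c∈ with c ≟ p | c ≟ q | c∈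
  ... | yes _ | _     | _        = refl
  ... | no _  | yes _ | _        = refl
  ... | no c≢p | no _ | inj₁ c≡p = ⊥-elim (c≢p c≡p)
  ... | no _  | no c≢q | inj₂ c≡q = ⊥-elim (c≢q c≡q)

  merge-id : ∀ {p q c} r → c ≢ p → c ≢ q → merge p q r c ≡ c
  merge-id {p} {q} {c} r c≢p c≢q with c ≟ p | c ≟ q
  ... | yes c≡p | _       = ⊥-elim (c≢p c≡p)
  ... | no _    | yes c≡q = ⊥-elim (c≢q c≡q)
  ... | no _    | no _    = refl

  data MergeView (p q r c : Fin n) : Set where
    merged : c ≡ p ⊎ c ≡ q → merge p q r c ≡ r → MergeView p q r c
    kept   : c ≢ p → c ≢ q → merge p q r c ≡ c → MergeView p q r c

  mergeView : ∀ p q r c → MergeView p q r c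
  mergeView p q r c with c ≟ p | c ≟ q
  ... | yes c≡p | _       = merged (inj₁ c≡p) (merge-≡ʳ p q r (inj₁ c≡p))
  ... | no _    | yes c≡q = merged (inj₂ c≡q) (merge-≡ʳ p q r (inj₂ c≡q))
  ... | no c≢p  | no c≢q  = kept c≢p c≢q (merge-id r c≢p c≢q)

  merge-≡-apart : ∀ {p q r c t} → t ≢ p → t ≢ q → t ≢ r → merge p q r c ≡ t → c ≡ t
  merge-≡-apart {p} {q} {r} {c} t≢p t≢q t≢r eq with mergeView p q r c
  ... | merged _ ≡r   = ⊥-elim (t≢r (trans (sym eq) ≡r))
  ... | kept _ _ ≡c   = trans (sym ≡c) eq

  merge-comm : ∀ {p q r p′ q′ r′} → r ≡ p ⊎ r ≡ q → r′ ≡ p′ ⊎ r′ ≡ q′ →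
               (∀ {s t} → s ≡ p ⊎ s ≡ q → t ≡ p′ ⊎ t ≡ q′ → s ≢ t) →
               merge p′ q′ r′ ∘ merge p q r ≗ merge p q r ∘ merge p′ q′ r′
  merge-comm {p} {q} {r} {p′} {q′} {r′} r∈ r′∈ apart c with mergeView p q r c
  ... | merged c∈ ≡r = begin
    merge p′ q′ r′ (merge p q r c)  ≡⟨ cong (merge p′ q′ r′) ≡r ⟩
    merge p′ q′ r′ r                ≡⟨ merge-id r′ (apart r∈ (inj₁ refl)) (apart r∈ (inj₂ refl)) ⟩
    r                               ≡⟨ ≡r ⟨
    merge p q r c                   ≡⟨ cong (merge p q r) (merge-id r′ (apart c∈ (inj₁ refl)) (apart c∈ (inj₂ refl))) ⟨
    merge p q r (merge p′ q′ r′ c)  ∎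
    where open ≡-Reasoning
  ... | kept c≢p c≢q ≡c with mergeView p′ q′ r′ c
  ...   | merged _ ≡r′ = begin
    merge p′ q′ r′ (merge p q r c)  ≡⟨ cong (merge p′ q′ r′) ≡c ⟩
    merge p′ q′ r′ c                ≡⟨ ≡r′ ⟩
    r′                              ≡⟨ merge-id r (apart (inj₁ refl) r′∈ ∘ sym) (apart (inj₂ refl) r′∈ ∘ sym) ⟨
    merge p q r r′                  ≡⟨ cong (merge p q r) ≡r′ ⟨
    merge p q r (merge p′ q′ r′ c)  ∎
    where open ≡-Reasoning
  ...   | kept _ _ ≡c′ = begin
    merge p′ q′ r′ (merge p q r c)  ≡⟨ cong (merge p′ q′ r′) ≡c ⟩
    merge p′ q′ r′ c                ≡⟨ ≡c′ ⟩
    c                               ≡⟨ ≡c ⟨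
    merge p q r c                   ≡⟨ cong (merge p q r) ≡c′ ⟨
    merge p q r (merge p′ q′ r′ c)  ∎
    where open ≡-Reasoning

  merge-nested : ∀ {p q r s} → r ≡ p ⊎ r ≡ q →
                 merge r s r ∘ merge p q r ≗ merge p q r ∘ merge p s p
  merge-nested {p} {q} {r} {s} r∈ c with mergeView p q r c | mergeView p s p c
  ... | merged _ ≡r | merged _ ≡p = begin
    merge r s r (merge p q r c)  ≡⟨ cong (merge r s r) ≡r ⟩
    merge r s r r                ≡⟨ merge-≡ʳ r s r (inj₁ refl) ⟩
    r                            ≡⟨ merge-≡ʳ p q r (inj₁ refl) ⟨
    merge p q r p                ≡⟨ cong (merge p q r) ≡p ⟨
    merge p q r (merge p s p c)  ∎
    where open ≡-Reasoning
  ... | merged _ ≡r | kept _ _ ≡c = begin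
    merge r s r (merge p q r c)  ≡⟨ cong (merge r s r) ≡r ⟩
    merge r s r r                ≡⟨ merge-≡ʳ r s r (inj₁ refl) ⟩
    r                            ≡⟨ ≡r ⟨
    merge p q r c                ≡⟨ cong (merge p q r) ≡c ⟨
    merge p q r (merge p s p c)  ∎
    where open ≡-Reasoning
  ... | kept c≢p _ _ | merged (inj₁ c≡p) _ = ⊥-elim (c≢p c≡p)
  ... | kept _ _ ≡c | merged (inj₂ c≡s) ≡p = begin
    merge r s r (merge p q r c)  ≡⟨ cong (merge r s r) ≡c ⟩
    merge r s r c                ≡⟨ merge-≡ʳ r s r (inj₂ c≡s) ⟩
    r                            ≡⟨ merge-≡ʳ p q r (inj₁ refl) ⟨
    merge p q r p                ≡⟨ cong (merge p q r) ≡p ⟨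
    merge p q r (merge p s p c)  ∎
    where open ≡-Reasoning
  ... | kept c≢p c≢q ≡c | kept _ c≢s ≡c′ = begin
    merge r s r (merge p q r c)  ≡⟨ cong (merge r s r) ≡c ⟩
    merge r s r c                ≡⟨ merge-id r c≢r c≢s ⟩
    c                            ≡⟨ ≡c ⟨
    merge p q r c                ≡⟨ cong (merge p q r) ≡c′ ⟨
    merge p q r (merge p s p c)  ∎
    where
    open ≡-Reasoning
    c≢r : c ≢ r
    c≢r = ≢-either c≢p c≢q r∈

  lookup-mergeBlocks : ∀ (x : Vec (Fin n) n) p q r i →
                       lookup (mergeBlocks x p q r) i ≡ merge p q r (lookup x i)
  lookup-mergeBlocks x p q r i = lookup-map i (merge p q r) x

  record IsBlock (x : Vec (Fin n) n) (t m : Fin n) : Set where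
    constructor block
    field
      point : lookup x t ≡ t
      min   : IsBlockMin x t m
  open IsBlock

  IsBlock-unique : ∀ {x : Vec (Fin n) n} {t m m′} → IsBlock x t m → IsBlock x t m′ → m ≡ m′
  IsBlock-unique (block _ (xm≡t , m-min)) (block _ (xm′≡t , m′-min)) =
    ≤-antisym (m-min _ xm′≡t) (m′-min _ xm≡t)

  IsBlock⇒≢ : ∀ {x : Vec (Fin n) n} {p q a b} → IsBlock x p a → IsBlock x q b → a ≢ b → p ≢ q
  IsBlock⇒≢ P Q a≢b refl = a≢b (IsBlock-unique P Q)

  module _ {x : Vec (Fin n) n} {p q r t : Fin n} where

    lookup-mergeBlocks-apart⁺ : t ≢ p → t ≢ q → ∀ {i} →
                                lookup x i ≡ t → lookup (mergeBlocks x p q r) i ≡ t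
    lookup-mergeBlocks-apart⁺ t≢p t≢q {i} xi≡t =
      trans (lookup-mergeBlocks x p q r i) (trans (cong (merge p q r) xi≡t) (merge-id r t≢p t≢q))

    lookup-mergeBlocks-apart⁻ : t ≢ p → t ≢ q → t ≢ r → ∀ {i} →
                                lookup (mergeBlocks x p q r) i ≡ t → lookup x i ≡ t
    lookup-mergeBlocks-apart⁻ t≢p t≢q t≢r {i} zi≡t =
      merge-≡-apart t≢p t≢q t≢r (trans (sym (lookup-mergeBlocks x p q r i)) zi≡t)

    fixed-mergeBlocks⇒apart : lookup (mergeBlocks x p q r) t ≡ t → t ≢ r → t ≢ p × t ≢ q
    fixed-mergeBlocks⇒apart zt≡t t≢r with mergeView p q r (lookup x t)
    ... | merged _ ≡r = ⊥-elim (t≢r (trans (sym zt≡t) (trans (lookup-mergeBlocks x p q r t) ≡r)))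
    ... | kept xt≢p xt≢q ≡xt = xt≢p ∘ trans xt≡t , xt≢q ∘ trans xt≡t
      where
      xt≡t : lookup x t ≡ t
      xt≡t = trans (sym ≡xt) (trans (sym (lookup-mergeBlocks x p q r t)) zt≡t)

    IsBlock-mergeBlocks⁺ : t ≢ p → t ≢ q → t ≢ r → ∀ {m} → IsBlock x t m → IsBlock (mergeBlocks x p q r) t m
    IsBlock-mergeBlocks⁺ t≢p t≢q t≢r (block xt≡t (xm≡t , m-min)) = block
        (lookup-mergeBlocks-apart⁺ t≢p t≢q xt≡t)
      ( lookup-mergeBlocks-apart⁺ t≢p t≢q xm≡t
      , λ i zi≡t → m-min i (lookup-mergeBlocks-apart⁻ t≢p t≢q t≢r zi≡t))

    IsBlock-mergeBlocks⁻ : t ≢ p → t ≢ q → t ≢ r → ∀ {m} → IsBlock (mergeBlocks x p q r) t m → IsBlock x t m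
    IsBlock-mergeBlocks⁻ t≢p t≢q t≢r (block zt≡t (zm≡t , m-min)) = block
        (lookup-mergeBlocks-apart⁻ t≢p t≢q t≢r zt≡t)
      ( lookup-mergeBlocks-apart⁻ t≢p t≢q t≢r zm≡t
      , λ i xi≡t → m-min i (lookup-mergeBlocks-apart⁺ t≢p t≢q xi≡t))

  IsBlock-mergeBlocks-merged : ∀ {x : Vec (Fin n) n} {p q a b} r → IsBlock x p a → IsBlock x q b → a ≤ᶠ b →
                               r ≡ p ⊎ r ≡ q → IsBlock (mergeBlocks x p q r) r a
  IsBlock-mergeBlocks-merged {x} {p} {q} {a} {b} r
                             (block xp≡p (xa≡p , a-min)) (block xq≡q (_ , b-min)) a≤b r∈ =
    block zr≡r (za≡r , a-min′)
    where
    xr≡r : lookup x r ≡ r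
    xr≡r = [ (λ r≡p → subst (λ t → lookup x t ≡ t) (sym r≡p) xp≡p)
           , (λ r≡q → subst (λ t → lookup x t ≡ t) (sym r≡q) xq≡q) ] r∈
    zr≡r = trans (lookup-mergeBlocks x p q r r) (trans (cong (merge p q r) xr≡r) (merge-≡ʳ p q r r∈))
    za≡r = trans (lookup-mergeBlocks x p q r a) (merge-≡ʳ p q r (inj₁ xa≡p))
    a-min′ : ∀ i → lookup (mergeBlocks x p q r) i ≡ r → a ≤ᶠ i
    a-min′ i zi≡r with mergeView p q r (lookup x i)
    ... | merged (inj₁ xi≡p) _ = a-min i xi≡p
    ... | merged (inj₂ xi≡q) _ = ≤-trans a≤b (b-min i xi≡q)
    ... | kept xi≢p xi≢q ≡xi =
      ⊥-elim (≢-either xi≢p xi≢q r∈ (trans (sym ≡xi) (trans (sym (lookup-mergeBlocks x p q r i)) zi≡r)))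

  mergeLabel-intro : ∀ {x : Vec (Fin n) n} {p q a b} u → IsBlock x p a → IsBlock x q b → a <ᶠ b →
                     MergeLabel x (mergeBlocks x p q (if u then p else q)) (lab a b u)
  mergeLabel-intro u (block xp≡p A) (block xq≡q B) a<b = _ , _ , xp≡p , xq≡q , A , B , a<b , refl

  mergedBlock : ∀ {x : Vec (Fin n) n} {p q a b} u → IsBlock x p a → IsBlock x q b → a <ᶠ b →
                let r = if u then p else q in IsBlock (mergeBlocks x p q r) r a
  mergedBlock {p = p} {q} u P Q a<b = IsBlock-mergeBlocks-merged _ P Q (<⇒≤ a<b) (if-either u p q)

  MergeLabel-functional : ∀ {x w w′ : Vec (Fin n) n} {l} → MergeLabel x w l → MergeLabel x w′ l → w ≡ w′
  MergeLabel-functional (_ , _ , _ , _ , (refl , _) , (refl , _) , _ , refl)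
                        (_ , _ , _ , _ , (refl , _) , (refl , _) , _ , refl) = refl

  <Λ⇒≤ : ∀ {l l′ : Label n} → l <Λ l′ → a l ≤ᶠ a l′
  <Λ⇒≤ (inj₁ a<a′)                = <⇒≤ a<a′
  <Λ⇒≤ (inj₂ (inj₁ (a≡a′ , _)))   = ≤-reflexive (cong toℕ a≡a′)
  <Λ⇒≤ (inj₂ (inj₂ (a≡a′ , _)))   = ≤-reflexive (cong toℕ a≡a′)

  <Λ∧≡⇒1-merge : ∀ {l l′ : Label n} → l <Λ l′ → a l ≡ a l′ → u l′ ≡ true
  <Λ∧≡⇒1-merge (inj₁ a<a′) a≡a′                  = ⊥-elim (<⇒≢ a<a′ a≡a′)
  <Λ∧≡⇒1-merge (inj₂ (inj₁ (_ , _ , u′≡1))) _     = u′≡1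
  <Λ∧≡⇒1-merge (inj₂ (inj₂ (_ , _ , u′≡1 , _))) _ = u′≡1

  switch-disjoint :
    ∀ {x : Vec (Fin n) n} {p q p₂ q₂ a b c d} u v →
    IsBlock x p a → IsBlock x q b → a <ᶠ b →
    let r = if u then p else q ; z = mergeBlocks x p q r in
    IsBlock z p₂ c → IsBlock z q₂ d → c <ᶠ d → p₂ ≢ r → a ≤ᶠ c →
    Σ[ w ∈ Vec (Fin n) n ]
      MergeLabel x w (lab c d v) × MergeLabel w (mergeBlocks z p₂ q₂ (if v then p₂ else q₂)) (lab a b u)
  switch-disjoint {x} {p} {q} {p₂} {q₂} u v P Q a<b P₂ Q₂ c<d p₂≢r a≤c =
    w , mergeLabel-intro v P₂ˣ Q₂ˣ c<d
      , subst (λ y → MergeLabel w y _) merges-commute (mergeLabel-intro u Pʷ Qʷ a<b)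
    where
    r  = if u then p else q
    r₂ = if v then p₂ else q₂
    w  = mergeBlocks x p₂ q₂ r₂
    q₂≢r = IsBlock⇒≢ Q₂ (mergedBlock u P Q a<b) (<⇒≢ (≤-<-trans a≤c c<d) ∘ sym)
    p₂∉ = fixed-mergeBlocks⇒apart {x = x} (point P₂) p₂≢r
    q₂∉ = fixed-mergeBlocks⇒apart {x = x} (point Q₂) q₂≢r
    P₂ˣ = IsBlock-mergeBlocks⁻ (proj₁ p₂∉) (proj₂ p₂∉) p₂≢r P₂
    Q₂ˣ = IsBlock-mergeBlocks⁻ (proj₁ q₂∉) (proj₂ q₂∉) q₂≢r Q₂
    apart : ∀ {s t} → s ≡ p₂ ⊎ s ≡ q₂ → t ≡ p ⊎ t ≡ q → s ≢ t
    apart s∈ t∈ s≡t = [ (λ s≡p₂ → ≢-either (proj₁ p₂∉) (proj₂ p₂∉) t∈ (trans (sym s≡p₂) s≡t))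
                      , (λ s≡q₂ → ≢-either (proj₁ q₂∉) (proj₂ q₂∉) t∈ (trans (sym s≡q₂) s≡t)) ] s∈
    apartˡ : ∀ {t} → t ≡ p ⊎ t ≡ q → t ≢ p₂ × t ≢ q₂ × t ≢ r₂
    apartˡ t∈ = (λ t≡p₂ → apart (inj₁ refl) t∈ (sym t≡p₂))
              , (λ t≡q₂ → apart (inj₂ refl) t∈ (sym t≡q₂))
              , (λ t≡r₂ → apart (if-either v p₂ q₂) t∈ (sym t≡r₂))
    Pʷ = let (p≢p₂ , p≢q₂ , p≢r₂) = apartˡ (inj₁ refl) in IsBlock-mergeBlocks⁺ p≢p₂ p≢q₂ p≢r₂ P
    Qʷ = let (q≢p₂ , q≢q₂ , q≢r₂) = apartˡ (inj₂ refl) in IsBlock-mergeBlocks⁺ q≢p₂ q≢q₂ q≢r₂ Q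
    merges-commute : mergeBlocks w p q r ≡ mergeBlocks (mergeBlocks x p q r) p₂ q₂ r₂
    merges-commute = map-exchange (merge-comm (if-either v p₂ q₂) (if-either u p q) apart) x

  switch-nested :
    ∀ {x : Vec (Fin n) n} {p q s a b d} u →
    IsBlock x p a → IsBlock x q b → a <ᶠ b →
    let r = if u then p else q ; z = mergeBlocks x p q r in
    IsBlock z s d → a <ᶠ d →
    Σ[ w ∈ Vec (Fin n) n ] MergeLabel x w (lab a d true) × MergeLabel w (mergeBlocks z r s r) (lab a b u)
  switch-nested {x} {p} {q} {s} u P Q a<b S a<d =
    w , mergeLabel-intro true P Sˣ a<d
      , subst (λ y → MergeLabel w y _) merges-commute (mergeLabel-intro u Pʷ Qʷ a<b)
    where
    r = if u then p else q
    w = mergeBlocks x p s p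
    s≢r = IsBlock⇒≢ S (mergedBlock u P Q a<b) (<⇒≢ a<d ∘ sym)
    s∉ = fixed-mergeBlocks⇒apart {x = x} (point S) s≢r
    Sˣ = IsBlock-mergeBlocks⁻ (proj₁ s∉) (proj₂ s∉) s≢r S
    q≢p : q ≢ p
    q≢p = IsBlock⇒≢ Q P (<⇒≢ a<b ∘ sym)
    Pʷ = IsBlock-mergeBlocks-merged p P Sˣ (<⇒≤ a<d) (inj₁ refl)
    Qʷ = IsBlock-mergeBlocks⁺ q≢p (proj₂ s∉ ∘ sym) q≢p Q
    merges-commute : mergeBlocks w p q r ≡ mergeBlocks (mergeBlocks x p q r) r s r
    merges-commute = map-exchange (sym ∘ merge-nested (if-either u p q)) x

  switch-blocks :
    ∀ {x : Vec (Fin n) n} {p q p₂ q₂ a b c d} u v →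
    IsBlock x p a → IsBlock x q b → a <ᶠ b →
    let r = if u then p else q ; z = mergeBlocks x p q r in
    IsBlock z p₂ c → IsBlock z q₂ d → c <ᶠ d → lab a b u <Λ lab c d v →
    Σ[ w ∈ Vec (Fin n) n ]
      MergeLabel x w (lab c d v) × MergeLabel w (mergeBlocks z p₂ q₂ (if v then p₂ else q₂)) (lab a b u)
  switch-blocks {p = p} {q} {p₂} u v P Q a<b P₂ Q₂ c<d l₁<l₂ with p₂ ≟ (if u then p else q)
  ... | no p₂≢r = switch-disjoint u v P Q a<b P₂ Q₂ c<d p₂≢r (<Λ⇒≤ l₁<l₂)
  ... | yes refl with IsBlock-unique (mergedBlock u P Q a<b) P₂
  ...   | refl with <Λ∧≡⇒1-merge l₁<l₂ refl
  ...     | refl = switch-nested u P Q a<b Q₂ c<d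

  switch : ∀ {x z y : Vec (Fin n) n} {l₁ l₂} → MergeLabel x z l₁ → MergeLabel z y l₂ → l₁ <Λ l₂ →
           Σ[ w ∈ Vec (Fin n) n ] MergeLabel x w l₂ × MergeLabel w y l₁
  switch {l₁ = lab _ _ u} {lab _ _ v} (_ , _ , xp≡p , xq≡q , A , B , a<b , refl)
                                      (_ , _ , zp₂≡p₂ , zq₂≡q₂ , C , D , c<d , refl) =
    switch-blocks u v (block xp≡p A) (block xq≡q B) a<b (block zp₂≡p₂ C) (block zq₂≡q₂ D) c<d

proposition2p12 : (n : ℕ) → 1 ≤ n →
    (x z y : Vec (Fin n) n) → IsPointedPartition x →
    (l₁ l₂ : Label n) → MergeLabel x z l₁ → MergeLabel z y l₂ → l₁ <Λ l₂ →
    Σ[ w ∈ Vec (Fin n) n ]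
      ((MergeLabel x w l₂ × MergeLabel w y l₁)
      × (∀ w' → MergeLabel x w' l₂ → MergeLabel w' y l₁ → w' ≡ w))
proposition2p12 n _ x z y _ l₁ l₂ xz zy l₁<l₂ with switch xz zy l₁<l₂
... | w , xw , wy = w , (xw , wy) , λ w′ xw′ _ → MergeLabel-functional xw′ xw
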